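{- Let $w=(u,v)\in\mathrm{WI}_n\times\mathrm{Cay}_n$. Then $\mathrm{Des}(u)\subseteq\mathrm{Des}(v)$ if and only if $(w^T)^T=w$. Moreover, the Burge transpose $T$ maps $\mathrm{Bur}_n=\{(u,v)\in\mathrm{WI}_n\times\mathrm{Cay}_n:\mathrm{Des}(u)\subseteq\mathrm{Des}(v)\}$ to itself and is an involution on $\mathrm{Bur}_n$.
   Context: A Cayley permutation of length $n$ is a word $x=x(1)\cdots x(n)$ of positive integers in which every integer from $1$ to $\max(x)$ occurs; $\mathrm{Cay}_n$ is the set of these and $\mathrm{WI}_n\subseteq\mathrm{Cay}_n$ the weakly increasing ones. $\mathrm{Des}(v)=\{i\in[n-1]: v(i)\ge v(i+1)\}$ is the set of weak descents of $v$. For $(u,v)\in\mathrm{WI}_n\times\mathrm{Cay}_n$, view $(u,v)$ as the sequence of columns $\binom{u(i)}{v(i)}$; its Burge transpose $(u,v)^T$ is obtained by turning every column upside down to $\binom{v(i)}{u(i)}$ and then sorting the columns in increasing order of top entry, breaking ties by sorting in decreasing order of bottom entry (the result again lies in $\mathrm{WI}_n\times\mathrm{Cay}_n$). -}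

module Defs where

open import Data.Nat using (ℕ; zero; suc; _≤_; _⊔_; _<ᵇ_; _≡ᵇ_; _≤ᵇ_)
open import Data.Bool using (Bool; true; false; if_then_else_; _∨_; _∧_)
open import Data.List using (List; []; _∷_; length; foldr; map; zip; unzip)
open import Data.List.Relation.Unary.All using (All)
open import Data.List.Relation.Unary.Linked using (Linked)
open import Data.List.Membership.Propositional using (_∈_)
open import Data.Product using (_×_; _,_; proj₁; proj₂; swap)
open import Data.Empty using (⊥)
open import Relation.Binary.PropositionalEquality using (_≡_)

-- Words are lists of naturals; positions are 1-indexed as in the paper.

maxW : List ℕ → ℕ
maxW = foldr _⊔_ 0

Cay : ℕ → List ℕ → Set
Cay n x = (length x ≡ n) × All (λ a → 1 ≤ a) x × (∀ k → 1 ≤ k → k ≤ maxW x → k ∈ x)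

WI : ℕ → List ℕ → Set
WI n x = Cay n x × Linked _≤_ x

-- i ∈ Des(x), i 1-indexed:  x(i) ≥ x(i+1)
DesAt : List ℕ → ℕ → Set
DesAt (a ∷ b ∷ xs) (suc zero)    = b ≤ a
DesAt (a ∷ xs)     (suc (suc i)) = DesAt xs (suc i)
DesAt _            _             = ⊥

DesSub : List ℕ → List ℕ → Set
DesSub u v = ∀ i → DesAt u i → DesAt v i

colLeq : ℕ × ℕ → ℕ × ℕ → Bool
colLeq (a , b) (c , d) = (a <ᵇ c) ∨ ((a ≡ᵇ c) ∧ (d ≤ᵇ b))

insertCol : ℕ × ℕ → List (ℕ × ℕ) → List (ℕ × ℕ)
insertCol x []       = x ∷ []
insertCol x (y ∷ ys) = if colLeq x y then x ∷ y ∷ ys else y ∷ insertCol x ys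

sortCols : List (ℕ × ℕ) → List (ℕ × ℕ)
sortCols = foldr insertCol []

burge : List ℕ × List ℕ → List ℕ × List ℕ
burge (u , v) = unzip (sortCols (map swap (zip u v)))

Bur : ℕ → List ℕ × List ℕ → Set
Bur n (u , v) = WI n u × Cay n v × DesSub u v

-- The Burge transpose of w = (u , v) is "swap the two rows, then sort the columns".
-- Applying it twice returns the columns of w sorted in the column order, so w is
-- fixed by T ∘ T exactly when its column list is already sorted. For a weakly
-- increasing top row u, the columns are sorted iff every tie u(i) = u(i+1) has
-- v(i) ≥ v(i+1), i.e. iff Des(u) ⊆ Des(v). Finally T(w) always has sorted columns,
-- and its rows are rearrangements of v and u, so T maps Bur_n into itself.
module Submission where

open import Defs
open import Data.Bool using (if_then_else_)
open import Data.List using (List; []; _∷_; map; zip; unzip; length)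
open import Data.List.Properties
  using (map-id; map-∘; zipWith-unzipWith; unzipWith-zipWith; unzipWith-map; unzipWith-swap)
open import Data.List.Relation.Binary.Equality.Propositional using (≋⇒≡)
open import Data.List.Relation.Binary.Permutation.Propositional
  using (_↭_; ↭-sym; ↭⇒↭ₛ; module PermutationReasoning)
open import Data.List.Relation.Binary.Permutation.Propositional.Properties
  using (map⁺; All-resp-↭; ∈-resp-↭; ↭-length)
open import Data.List.Relation.Binary.Permutation.Setoid.Properties using (foldr-commMonoid)
open import Data.List.Relation.Unary.Linked using (Linked; []; [-]; _∷_)
open import Data.List.Relation.Unary.Sorted.TotalOrder.Properties using (↗↭↗⇒≋)
open import Data.Nat using (ℕ; zero; suc; _≤_; _<_; _≥_)
open import Data.Nat.Properties
  using ( _≟_; <ᵇ-reflects-<; ≤ᵇ-reflects-≤; ≡ᵇ⇒≡; ≡⇒≡ᵇ; suc-injective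
        ; ≤-refl; ≤-trans; ≤-antisym; ≤-total; <-trans; <-cmp; <-irrefl; <-asym
        ; <⇒≤; <⇒≱; m≤n⇒m<n∨m≡n; ⊔-0-isCommutativeMonoid)
open import Data.Product using (_×_; _,_; proj₁; proj₂; swap)
open import Data.Product.Properties using (≡-dec)
open import Data.Product.Relation.Binary.Lex.Strict using (×-Lex; ×-transitive; ×-total₂)
open import Data.Sum using (inj₁; inj₂)
open import Data.Empty using (⊥-elim)
open import Function.Base using (_∘_)
open import Function.Bundles using (_⇔_; mk⇔; Equivalence)
open import Function.Construct.Composition using (_⇔-∘_)
open import Level using (0ℓ)
open import Relation.Binary.Bundles using (DecTotalOrder)
open import Relation.Binary.Core using (Rel; _Preserves_⟶_)
open import Relation.Binary.Definitions using (Decidable; Antisymmetric)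
open import Relation.Binary.PropositionalEquality
  using (_≡_; _≗_; refl; sym; trans; cong; subst; subst₂; isEquivalence; resp₂; setoid; module ≡-Reasoning)
open import Relation.Nullary.Decidable using (_because_)
open import Relation.Nullary.Negation using (¬_)
open import Relation.Nullary.Reflects using (Reflects; fromEquivalence; _⊎-reflects_; _×-reflects_)

Col : Set
Col = ℕ × ℕ

_≼_ : Rel Col 0ℓ
_≼_ = ×-Lex _≡_ _<_ _≥_

≼-reflects : ∀ p q → Reflects (p ≼ q) (colLeq p q)
≼-reflects (a , b) (c , d) =
  <ᵇ-reflects-< a c ⊎-reflects fromEquivalence (≡ᵇ⇒≡ a c) (≡⇒≡ᵇ a c) ×-reflects ≤ᵇ-reflects-≤ d b

-- The boolean part of this decision is literally colLeq, so the library's insertion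
-- sort for the order below unfolds to sortCols.
_≼?_ : Decidable _≼_
p ≼? q = colLeq p q because ≼-reflects p q

≼-antisym : Antisymmetric _≡_ _≼_
≼-antisym (inj₁ a<c) (inj₁ c<a) = ⊥-elim (<-asym a<c c<a)
≼-antisym (inj₁ a<c) (inj₂ (c≡a , _)) = ⊥-elim (<-irrefl (sym c≡a) a<c)
≼-antisym (inj₂ (a≡c , _)) (inj₁ c<a) = ⊥-elim (<-irrefl (sym a≡c) c<a)
≼-antisym {a , _} (inj₂ (refl , d≤b)) (inj₂ (_ , b≤d)) = cong (a ,_) (≤-antisym b≤d d≤b)

≼-proj₁ : ∀ {p q} → p ≼ q → proj₁ p ≤ proj₁ q
≼-proj₁ (inj₁ a<c) = <⇒≤ a<c
≼-proj₁ (inj₂ (refl , _)) = ≤-refl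

columnOrder : DecTotalOrder 0ℓ 0ℓ 0ℓ
columnOrder = record
  { isDecTotalOrder = record
    { isTotalOrder = record
      { isPartialOrder = record
        { isPreorder = record
          { isEquivalence = isEquivalence
          ; reflexive = λ { refl → inj₂ (refl , ≤-refl) }
          ; trans = ×-transitive {_<₂_ = _≥_} isEquivalence (resp₂ _<_) <-trans
                      (λ b≥d d≥f → ≤-trans d≥f b≥d)
          }
        ; antisym = ≼-antisym
        }
      ; total = ×-total₂ {_<₂_ = _≥_} sym <-cmp (λ b d → ≤-total d b)
      }
    ; _≟_ = ≡-dec _≟_ _≟_
    ; _≤?_ = _≼?_
    }
  }

open DecTotalOrder columnOrder using (totalOrder)
open import Data.List.Relation.Unary.Sorted.TotalOrder totalOrder using (Sorted)
open import Data.List.Sort.InsertionSort.Base columnOrder using (insert; sort)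
open import Data.List.Sort.InsertionSort.Properties columnOrder using (sort-↭; sort-↗)

insertCol≗insert : ∀ x → insertCol x ≗ insert x
insertCol≗insert x [] = refl
insertCol≗insert x (y ∷ ys) =
  cong (λ r → if colLeq x y then x ∷ y ∷ ys else y ∷ r) (insertCol≗insert x ys)

sortCols≗sort : sortCols ≗ sort
sortCols≗sort [] = refl
sortCols≗sort (x ∷ xs) = trans (insertCol≗insert x (sortCols xs)) (cong (insert x) (sortCols≗sort xs))

transposeCols : List Col → List Col
transposeCols xs = sort (map swap xs)

map-swap-involutive : ∀ (xs : List Col) → map swap (map swap xs) ≡ xs
map-swap-involutive xs = trans (sym (map-∘ xs)) (map-id xs)

transposeCols²-↭ : ∀ xs → transposeCols (transposeCols xs) ↭ xs
transposeCols²-↭ xs = begin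
  sort (map swap (sort (map swap xs))) ↭⟨ sort-↭ _ ⟩
  map swap (sort (map swap xs))        ↭⟨ map⁺ swap (sort-↭ _) ⟩
  map swap (map swap xs)               ≡⟨ map-swap-involutive xs ⟩
  xs                                   ∎
  where open PermutationReasoning

↗⇔transposeCols-involutive : ∀ xs → Sorted xs ⇔ transposeCols (transposeCols xs) ≡ xs
↗⇔transposeCols-involutive xs = mk⇔
  (λ xs↗ → ≋⇒≡ (↗↭↗⇒≋ totalOrder (sort-↗ (map swap (transposeCols xs))) xs↗
                                  (↭⇒↭ₛ (transposeCols²-↭ xs))))
  (λ eq → subst Sorted eq (sort-↗ (map swap (transposeCols xs))))

zip-unzip : ∀ (xs : List Col) → zip (proj₁ (unzip xs)) (proj₂ (unzip xs)) ≡ xs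
zip-unzip = zipWith-unzipWith (λ x → x) _,_ (λ _ → refl)

unzip-zip : ∀ (u v : List ℕ) → length u ≡ length v → unzip (zip u v) ≡ (u , v)
unzip-zip = unzipWith-zipWith (λ x → x) _,_ (λ _ → refl)

unzip-injective : ∀ {xs ys : List Col} → unzip xs ≡ unzip ys → xs ≡ ys
unzip-injective {xs} {ys} eq = begin
  xs                                        ≡⟨ sym (zip-unzip xs) ⟩
  zip (proj₁ (unzip xs)) (proj₂ (unzip xs)) ≡⟨ cong (λ w → zip (proj₁ w) (proj₂ w)) eq ⟩
  zip (proj₁ (unzip ys)) (proj₂ (unzip ys)) ≡⟨ zip-unzip ys ⟩
  ys                                        ∎
  where open ≡-Reasoning

burge-zip : ∀ u v → burge (u , v) ≡ unzip (transposeCols (zip u v))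
burge-zip u v = cong unzip (sortCols≗sort (map swap (zip u v)))

burge-unzip : ∀ xs → burge (unzip xs) ≡ unzip (transposeCols xs)
burge-unzip xs = begin
  burge (unzip xs)                                              ≡⟨ burge-zip (proj₁ (unzip xs)) (proj₂ (unzip xs)) ⟩
  unzip (transposeCols (zip (proj₁ (unzip xs)) (proj₂ (unzip xs)))) ≡⟨ cong (unzip ∘ transposeCols) (zip-unzip xs) ⟩
  unzip (transposeCols xs)                                      ∎
  where open ≡-Reasoning

burge²-zip : ∀ u v → burge (burge (u , v)) ≡ unzip (transposeCols (transposeCols (zip u v)))
burge²-zip u v = trans (cong burge (burge-zip u v)) (burge-unzip (transposeCols (zip u v)))

zip-↗⇔burge-involutive : ∀ {u v} → length u ≡ length v →
                         Sorted (zip u v) ⇔ burge (burge (u , v)) ≡ (u , v)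
zip-↗⇔burge-involutive {u} {v} |u|≡|v| = mk⇔
  (λ eq → trans (burge²-zip u v) (trans (cong unzip eq) unzip-zip-uv))
  (λ eq → unzip-injective (trans (sym (burge²-zip u v)) (trans eq (sym unzip-zip-uv))))
  ⇔-∘ ↗⇔transposeCols-involutive (zip u v)
  where
    unzip-zip-uv : unzip (zip u v) ≡ (u , v)
    unzip-zip-uv = unzip-zip u v |u|≡|v|

¬DesAt-zero : ∀ xs → ¬ DesAt xs zero
¬DesAt-zero []          ()
¬DesAt-zero (_ ∷ [])    ()
¬DesAt-zero (_ ∷ _ ∷ _) ()

zip-↗⇒DesSub : ∀ {u v} → length u ≡ length v → Sorted (zip u v) → DesSub u v
zip-↗⇒DesSub {a ∷ b ∷ _} {c ∷ d ∷ _} _ (inj₁ a<b ∷ _) 1 b≤a = ⊥-elim (<⇒≱ a<b b≤a)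
zip-↗⇒DesSub {a ∷ b ∷ _} {c ∷ d ∷ _} _ (inj₂ (_ , d≤c) ∷ _) 1 _ = d≤c
zip-↗⇒DesSub {_ ∷ _ ∷ _} {_ ∷ _ ∷ _} eq (_ ∷ ↗) (suc (suc i)) = zip-↗⇒DesSub (suc-injective eq) ↗ (suc i)
zip-↗⇒DesSub {u} _ _ zero = ⊥-elim ∘ ¬DesAt-zero u
zip-↗⇒DesSub {_ ∷ []} _ _ 1 ()
zip-↗⇒DesSub {_ ∷ []} _ _ (suc (suc _)) ()

DesSub⇒zip-↗ : ∀ {u v} → Linked _≤_ u → DesSub u v → Sorted (zip u v)
DesSub⇒zip-↗ {[]} _ _ = []
DesSub⇒zip-↗ {_ ∷ _} {[]} _ _ = []
DesSub⇒zip-↗ {_ ∷ []} {_ ∷ _} _ _ = [-]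
DesSub⇒zip-↗ {_ ∷ _ ∷ _} {_ ∷ []} _ _ = [-]
DesSub⇒zip-↗ {a ∷ b ∷ u} {c ∷ d ∷ v} (a≤b ∷ ↗) des =
  first ∷ DesSub⇒zip-↗ ↗ (λ { zero → ⊥-elim ∘ ¬DesAt-zero (b ∷ u) ; (suc i) → des (suc (suc i)) })
  where
    first : (a , c) ≼ (b , d)
    first with m≤n⇒m<n∨m≡n a≤b
    ... | inj₁ a<b = inj₁ a<b
    ... | inj₂ refl = inj₂ (refl , des 1 ≤-refl)

DesSub⇔zip-↗ : ∀ {u v} → length u ≡ length v → Linked _≤_ u → DesSub u v ⇔ Sorted (zip u v)
DesSub⇔zip-↗ |u|≡|v| u↗ = mk⇔ (DesSub⇒zip-↗ u↗) (zip-↗⇒DesSub |u|≡|v|)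

zip-↗⇒↗ : ∀ {u v} → length u ≡ length v → Sorted (zip u v) → Linked _≤_ u
zip-↗⇒↗ {[]} _ _ = []
zip-↗⇒↗ {_ ∷ []} _ _ = [-]
zip-↗⇒↗ {_ ∷ _ ∷ _} {_ ∷ _ ∷ _} eq (first ∷ ↗) = ≼-proj₁ first ∷ zip-↗⇒↗ (suc-injective eq) ↗

maxW-↭ : maxW Preserves _↭_ ⟶ _≡_
maxW-↭ p = foldr-commMonoid (setoid ℕ) ⊔-0-isCommutativeMonoid (↭⇒↭ₛ p)

Cay-resp-↭ : ∀ {n x y} → x ↭ y → Cay n x → Cay n y
Cay-resp-↭ x↭y (|x|≡n , positive , surjective) =
  trans (sym (↭-length x↭y)) |x|≡n ,
  All-resp-↭ x↭y positive ,
  λ k 1≤k k≤max → ∈-resp-↭ x↭y (surjective k 1≤k (subst (k ≤_) (sym (maxW-↭ x↭y)) k≤max))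

unzip-rows : ∀ (xs : List Col) → unzip xs ≡ (map proj₁ xs , map proj₂ xs)
unzip-rows [] = refl
unzip-rows (x ∷ xs) rewrite unzip-rows xs = refl

_↭ᵣ_ : List ℕ × List ℕ → List ℕ × List ℕ → Set
(u , v) ↭ᵣ (u′ , v′) = u ↭ u′ × v ↭ v′

unzip-↭ : ∀ {xs ys : List Col} → xs ↭ ys → unzip xs ↭ᵣ unzip ys
unzip-↭ {xs} {ys} xs↭ys rewrite unzip-rows xs | unzip-rows ys = map⁺ proj₁ xs↭ys , map⁺ proj₂ xs↭ys

unzip-map-swap : ∀ (xs : List Col) → unzip (map swap xs) ≡ swap (unzip xs)
unzip-map-swap xs = trans (unzipWith-map (λ x → x) swap xs) (unzipWith-swap (λ x → x) xs)

burge-↭ᵣ : ∀ u v → length u ≡ length v → burge (u , v) ↭ᵣ (v , u)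
burge-↭ᵣ u v |u|≡|v| =
  subst₂ _↭ᵣ_ (sym (burge-zip u v)) (trans (unzip-map-swap (zip u v)) (cong swap (unzip-zip u v |u|≡|v|)))
    (unzip-↭ (sort-↭ (map swap (zip u v))))

burge-↗ : ∀ w → Sorted (zip (proj₁ (burge w)) (proj₂ (burge w)))
burge-↗ (u , v) = subst Sorted (sym zip-rows) (sort-↗ (map swap (zip u v)))
  where
    zip-rows : zip (proj₁ (burge (u , v))) (proj₂ (burge (u , v))) ≡ transposeCols (zip u v)
    zip-rows = trans (cong (λ w → zip (proj₁ w) (proj₂ w)) (burge-zip u v)) (zip-unzip _)

zip-↗⇒Bur : ∀ {n u v} → Cay n u → Cay n v → Sorted (zip u v) → Bur n (u , v)
zip-↗⇒Bur cay-u@(|u|≡n , _) cay-v@(|v|≡n , _) ↗ =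
  (cay-u , zip-↗⇒↗ |u|≡|v| ↗) , cay-v , zip-↗⇒DesSub |u|≡|v| ↗
  where |u|≡|v| = trans |u|≡n (sym |v|≡n)

burge-Bur : ∀ {n} w → Bur n w → Bur n (burge w)
burge-Bur (u , v) ((cay-u@(|u|≡n , _) , _) , cay-v@(|v|≡n , _) , _) =
  let (top↭v , bottom↭u) = burge-↭ᵣ u v (trans |u|≡n (sym |v|≡n)) in
  zip-↗⇒Bur (Cay-resp-↭ (↭-sym top↭v) cay-v) (Cay-resp-↭ (↭-sym bottom↭u) cay-u) (burge-↗ (u , v))

mainTheorem11 : (n : ℕ) →
    ((u v : List ℕ) → WI n u → Cay n v →
      (DesSub u v ⇔ (burge (burge (u , v)) ≡ (u , v))))
    × ((w : List ℕ × List ℕ) → Bur n w → Bur n (burge w) × (burge (burge w) ≡ w))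
mainTheorem11 n = DesSub⇔burge-involutive , Bur-closed
  where
    DesSub⇔burge-involutive : (u v : List ℕ) → WI n u → Cay n v →
                              DesSub u v ⇔ (burge (burge (u , v)) ≡ (u , v))
    DesSub⇔burge-involutive u v ((|u|≡n , _) , u↗) (|v|≡n , _) =
      zip-↗⇔burge-involutive |u|≡|v| ⇔-∘ DesSub⇔zip-↗ |u|≡|v| u↗
      where |u|≡|v| = trans |u|≡n (sym |v|≡n)

    Bur-closed : (w : List ℕ × List ℕ) → Bur n w → Bur n (burge w) × (burge (burge w) ≡ w)
    Bur-closed (u , v) bur@(((|u|≡n , _) , u↗) , (|v|≡n , _) , des) =
      burge-Bur (u , v) bur ,
      Equivalence.to (zip-↗⇔burge-involutive (trans |u|≡n (sym |v|≡n))) (DesSub⇒zip-↗ u↗ des)
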